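{- Let $L$ be a $3$-Engel Lie algebra over a field of characteristic $5$ and fix $a\in L$. Define $f=f_a:L^2\to L$ by $f(x,y)=[a,[x,y],[x,y]]$. Then for all $x,y,z\in L$: (1) $f(x,x)=0$; (2) $f(x,y)=f(y,x)$; (3) $f([x,y],z)=f(x,[y,z])$.
   Context: Brackets are left-normed: $[a_1,\ldots,a_n]=[\ldots[[a_1,a_2],a_3],\ldots,a_n]$. A Lie algebra $L$ is $3$-Engel if $[a,b,b,b]=0$ for all $a,b\in L$. -}

module Defs where

open import Level using (Level; _⊔_)
open import Data.Nat using (ℕ; zero; suc; _<_)
open import Data.Product using (Σ; _×_)
open import Relation.Nullary using (¬_)
open import Algebra.Core using (Op₂)
open import Algebra.Bundles using (CommutativeRing)
open import Algebra.Module.Bundles using (Module)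

private variable r ℓr m ℓm : Level

module _ (K : CommutativeRing r ℓr) where
  open CommutativeRing K

  natToRing : ℕ → Carrier
  natToRing zero    = 0#
  natToRing (suc n) = 1# + natToRing n

  record IsField : Set (r ⊔ ℓr) where
    field
      1≉0     : ¬ (1# ≈ 0#)
      inverse : ∀ x → ¬ (x ≈ 0#) → Σ Carrier (λ y → (x * y) ≈ 1#)

  record HasCharacteristic (p : ℕ) : Set ℓr where
    field
      pos     : 0 < p
      annihil : natToRing p ≈ 0#
      minimal : ∀ n → 0 < n → n < p → ¬ (natToRing n ≈ 0#)

module _ {K : CommutativeRing r ℓr} (M : Module K m ℓm) where
  open CommutativeRing K using () renaming (Carrier to Scalar)
  open Module M

  record IsLieAlgebra (⁅_,_⁆ : Op₂ Carrierᴹ) : Set (r ⊔ m ⊔ ℓm) where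
    field
      ⁅⁆-cong   : ∀ {x x′ y y′} → x ≈ᴹ x′ → y ≈ᴹ y′ → ⁅ x , y ⁆ ≈ᴹ ⁅ x′ , y′ ⁆
      ⁅⁆-+ˡ     : ∀ x y z → ⁅ x +ᴹ y , z ⁆ ≈ᴹ ⁅ x , z ⁆ +ᴹ ⁅ y , z ⁆
      ⁅⁆-+ʳ     : ∀ x y z → ⁅ x , y +ᴹ z ⁆ ≈ᴹ ⁅ x , y ⁆ +ᴹ ⁅ x , z ⁆
      ⁅⁆-*ˡ     : ∀ (c : Scalar) x y → ⁅ c *ₗ x , y ⁆ ≈ᴹ c *ₗ ⁅ x , y ⁆
      ⁅⁆-*ʳ     : ∀ (c : Scalar) x y → ⁅ x , c *ₗ y ⁆ ≈ᴹ c *ₗ ⁅ x , y ⁆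
      ⁅⁆-alt    : ∀ x → ⁅ x , x ⁆ ≈ᴹ 0ᴹ
      ⁅⁆-jacobi : ∀ x y z →
        (⁅ ⁅ x , y ⁆ , z ⁆ +ᴹ ⁅ ⁅ y , z ⁆ , x ⁆) +ᴹ ⁅ ⁅ z , x ⁆ , y ⁆ ≈ᴹ 0ᴹ

  Is3Engel : Op₂ Carrierᴹ → Set (m ⊔ ℓm)
  Is3Engel ⁅_,_⁆ = ∀ a b → ⁅ ⁅ ⁅ a , b ⁆ , b ⁆ , b ⁆ ≈ᴹ 0ᴹ

  fₐ : Op₂ Carrierᴹ → Carrierᴹ → Carrierᴹ → Carrierᴹ → Carrierᴹ
  fₐ ⁅_,_⁆ a x y = ⁅ ⁅ a , ⁅ x , y ⁆ ⁆ , ⁅ x , y ⁆ ⁆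

{-# OPTIONS --safe #-}
module Submission where

-- (1) and (2) only use [x,x] = 0 and [y,x] = -[x,y]. For (3), write f(u,v) = a·(ad[u,v])²
-- with operators acting on the right. Expanding ad of a bracket by the Jacobi identity turns
-- both f([x,y],z) and f(x,[y,z]) into a acted on by polynomials in ad x, ad y, ad z with
-- coefficients mod 5. Their difference is an explicit combination of terms
-- P·(Σ_{σ ∈ S₃} ad b_σ1 ad b_σ2 ad b_σ3)·Q, and each such term annihilates L because
-- L is 3-Engel. The polynomial identity is checked by computing normal forms.

open import Defs
open import Level using (Level; _⊔_)
open import Data.Product using (_×_; _,_)
open import Algebra.Core using (Op₂)
open import Algebra.Bundles using (CommutativeRing; CommutativeMonoid)
open import Algebra.Module.Bundles using (Module)
open import Data.Nat.Base as ℕ using (ℕ; zero; suc; pred; NonZero)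
open import Data.Nat.Divisibility using (_∣_; _∣?_; divides; ∣-refl)
open import Data.Nat.Properties using (suc-pred)
open import Data.Bool.Base using (Bool; true; T; _∧_)
open import Data.Bool.Properties using (T-∧)
open import Data.List.Base using (List; []; _∷_)
open import Data.Unit.Base using (tt)
open import Function.Bundles using (Equivalence)
open import Relation.Nullary.Decidable.Core using (isYes; toWitness)
open import Relation.Binary.PropositionalEquality.Core using (refl; cong)
import Algebra.Module.Properties as ModuleProperties
import Algebra.Properties.CommutativeSemigroup as CommutativeSemigroupProperties
import Relation.Binary.Reasoning.Setoid as SetoidReasoning

private variable r ℓr m ℓm : Level

module LieAlgebraProperties {K : CommutativeRing r ℓr} {L : Module K m ℓm}
  {⁅_,_⁆ : Op₂ (Module.Carrierᴹ L)} (lie : IsLieAlgebra L ⁅_,_⁆) where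

  open CommutativeRing K using (0#)
  open Module L
  open IsLieAlgebra lie
  open ModuleProperties L using (inverseˡ-uniqueᴹ; -ᴹ-involutive)
  open SetoidReasoning ≈ᴹ-setoid

  ⁅⁆-zeroˡ : ∀ v → ⁅ 0ᴹ , v ⁆ ≈ᴹ 0ᴹ
  ⁅⁆-zeroˡ v = begin
    ⁅ 0ᴹ , v ⁆         ≈⟨ ⁅⁆-cong (*ₗ-zeroˡ 0ᴹ) ≈ᴹ-refl ⟨
    ⁅ 0# *ₗ 0ᴹ , v ⁆   ≈⟨ ⁅⁆-*ˡ 0# 0ᴹ v ⟩
    0# *ₗ ⁅ 0ᴹ , v ⁆   ≈⟨ *ₗ-zeroˡ _ ⟩
    0ᴹ                 ∎

  ⁅⁆-zeroʳ : ∀ v → ⁅ v , 0ᴹ ⁆ ≈ᴹ 0ᴹ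
  ⁅⁆-zeroʳ v = begin
    ⁅ v , 0ᴹ ⁆         ≈⟨ ⁅⁆-cong ≈ᴹ-refl (*ₗ-zeroˡ 0ᴹ) ⟨
    ⁅ v , 0# *ₗ 0ᴹ ⁆   ≈⟨ ⁅⁆-*ʳ 0# v 0ᴹ ⟩
    0# *ₗ ⁅ v , 0ᴹ ⁆   ≈⟨ *ₗ-zeroˡ _ ⟩
    0ᴹ                 ∎

  ⁅⁆-negˡ : ∀ u v → ⁅ -ᴹ u , v ⁆ ≈ᴹ -ᴹ ⁅ u , v ⁆
  ⁅⁆-negˡ u v = inverseˡ-uniqueᴹ _ _ (begin
    ⁅ -ᴹ u , v ⁆ +ᴹ ⁅ u , v ⁆   ≈⟨ ⁅⁆-+ˡ (-ᴹ u) u v ⟨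
    ⁅ -ᴹ u +ᴹ u , v ⁆           ≈⟨ ⁅⁆-cong (-ᴹ‿inverseˡ u) ≈ᴹ-refl ⟩
    ⁅ 0ᴹ , v ⁆                  ≈⟨ ⁅⁆-zeroˡ v ⟩
    0ᴹ                          ∎)

  ⁅⁆-negʳ : ∀ u v → ⁅ u , -ᴹ v ⁆ ≈ᴹ -ᴹ ⁅ u , v ⁆
  ⁅⁆-negʳ u v = inverseˡ-uniqueᴹ _ _ (begin
    ⁅ u , -ᴹ v ⁆ +ᴹ ⁅ u , v ⁆   ≈⟨ ⁅⁆-+ʳ u (-ᴹ v) v ⟨
    ⁅ u , -ᴹ v +ᴹ v ⁆           ≈⟨ ⁅⁆-cong ≈ᴹ-refl (-ᴹ‿inverseˡ v) ⟩
    ⁅ u , 0ᴹ ⁆                  ≈⟨ ⁅⁆-zeroʳ u ⟩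
    0ᴹ                          ∎)

  ⁅⁆-anticomm : ∀ u v → ⁅ u , v ⁆ ≈ᴹ -ᴹ ⁅ v , u ⁆
  ⁅⁆-anticomm u v = inverseˡ-uniqueᴹ _ _ (begin
    ⁅ u , v ⁆ +ᴹ ⁅ v , u ⁆                                ≈⟨ +ᴹ-cong (+ᴹ-identityˡ _) (+ᴹ-identityʳ _) ⟨
    (0ᴹ +ᴹ ⁅ u , v ⁆) +ᴹ (⁅ v , u ⁆ +ᴹ 0ᴹ)                ≈⟨ +ᴹ-cong (+ᴹ-cong (⁅⁆-alt u) ≈ᴹ-refl) (+ᴹ-cong ≈ᴹ-refl (⁅⁆-alt v)) ⟨
    (⁅ u , u ⁆ +ᴹ ⁅ u , v ⁆) +ᴹ (⁅ v , u ⁆ +ᴹ ⁅ v , v ⁆)  ≈⟨ +ᴹ-cong (⁅⁆-+ʳ u u v) (⁅⁆-+ʳ v u v) ⟨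
    ⁅ u , u +ᴹ v ⁆ +ᴹ ⁅ v , u +ᴹ v ⁆                      ≈⟨ ⁅⁆-+ˡ u v (u +ᴹ v) ⟨
    ⁅ u +ᴹ v , u +ᴹ v ⁆                                   ≈⟨ ⁅⁆-alt (u +ᴹ v) ⟩
    0ᴹ                                                    ∎)

  ⁅⁆-leibniz : ∀ w u v → ⁅ w , ⁅ u , v ⁆ ⁆ ≈ᴹ ⁅ ⁅ w , u ⁆ , v ⁆ +ᴹ -ᴹ ⁅ ⁅ w , v ⁆ , u ⁆
  ⁅⁆-leibniz w u v = begin
    ⁅ w , ⁅ u , v ⁆ ⁆                             ≈⟨ ⁅⁆-anticomm w _ ⟩
    -ᴹ ⁅ ⁅ u , v ⁆ , w ⁆                          ≈⟨ -ᴹ‿cong (inverseˡ-uniqueᴹ _ _ jacobi) ⟩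
    -ᴹ -ᴹ (⁅ ⁅ v , w ⁆ , u ⁆ +ᴹ ⁅ ⁅ w , u ⁆ , v ⁆)  ≈⟨ -ᴹ-involutive _ ⟩
    ⁅ ⁅ v , w ⁆ , u ⁆ +ᴹ ⁅ ⁅ w , u ⁆ , v ⁆         ≈⟨ +ᴹ-comm _ _ ⟩
    ⁅ ⁅ w , u ⁆ , v ⁆ +ᴹ ⁅ ⁅ v , w ⁆ , u ⁆         ≈⟨ +ᴹ-congˡ (⁅⁆-cong (⁅⁆-anticomm v w) ≈ᴹ-refl) ⟩
    ⁅ ⁅ w , u ⁆ , v ⁆ +ᴹ ⁅ -ᴹ ⁅ w , v ⁆ , u ⁆      ≈⟨ +ᴹ-congˡ (⁅⁆-negˡ _ u) ⟩
    ⁅ ⁅ w , u ⁆ , v ⁆ +ᴹ -ᴹ ⁅ ⁅ w , v ⁆ , u ⁆      ∎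
    where
    jacobi : ⁅ ⁅ u , v ⁆ , w ⁆ +ᴹ (⁅ ⁅ v , w ⁆ , u ⁆ +ᴹ ⁅ ⁅ w , u ⁆ , v ⁆) ≈ᴹ 0ᴹ
    jacobi = ≈ᴹ-trans (≈ᴹ-sym (+ᴹ-assoc _ _ _)) (⁅⁆-jacobi u v w)

  fₐ-diagonal : ∀ a x → fₐ L ⁅_,_⁆ a x x ≈ᴹ 0ᴹ
  fₐ-diagonal a x = ≈ᴹ-trans (⁅⁆-cong ≈ᴹ-refl (⁅⁆-alt x)) (⁅⁆-zeroʳ _)

  fₐ-comm : ∀ a x y → fₐ L ⁅_,_⁆ a x y ≈ᴹ fₐ L ⁅_,_⁆ a y x
  fₐ-comm a x y = ≈ᴹ-sym (begin
    ⁅ ⁅ a , ⁅ y , x ⁆ ⁆ , ⁅ y , x ⁆ ⁆   ≈⟨ ⁅⁆-cong (⁅⁆-cong ≈ᴹ-refl (⁅⁆-anticomm y x)) (⁅⁆-anticomm y x) ⟩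
    ⁅ ⁅ a , -ᴹ u ⁆ , -ᴹ u ⁆             ≈⟨ ⁅⁆-negʳ _ u ⟩
    -ᴹ ⁅ ⁅ a , -ᴹ u ⁆ , u ⁆             ≈⟨ -ᴹ‿cong (⁅⁆-cong (⁅⁆-negʳ a u) ≈ᴹ-refl) ⟩
    -ᴹ ⁅ -ᴹ ⁅ a , u ⁆ , u ⁆             ≈⟨ -ᴹ‿cong (⁅⁆-negˡ _ u) ⟩
    -ᴹ -ᴹ ⁅ ⁅ a , u ⁆ , u ⁆             ≈⟨ -ᴹ-involutive _ ⟩
    ⁅ ⁅ a , u ⁆ , u ⁆                   ∎)
    where
    u : Carrierᴹ
    u = ⁅ x , y ⁆

module _ (K : CommutativeRing r ℓr) where
  open CommutativeRing K
  open SetoidReasoning setoid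

  CharacteristicDivides : ℕ → Set ℓr
  CharacteristicDivides p = natToRing K p ≈ 0#

  natToRing-+ : ∀ m n → natToRing K (m ℕ.+ n) ≈ natToRing K m + natToRing K n
  natToRing-+ zero    n = sym (+-identityˡ _)
  natToRing-+ (suc m) n = trans (+-congˡ (natToRing-+ m n)) (sym (+-assoc _ _ _))

  natToRing-* : ∀ m n → natToRing K (m ℕ.* n) ≈ natToRing K m * natToRing K n
  natToRing-* zero    n = sym (zeroˡ _)
  natToRing-* (suc m) n = begin
    natToRing K (n ℕ.+ m ℕ.* n)                   ≈⟨ natToRing-+ n (m ℕ.* n) ⟩
    natToRing K n + natToRing K (m ℕ.* n)         ≈⟨ +-cong (sym (*-identityˡ _)) (natToRing-* m n) ⟩
    1# * natToRing K n + natToRing K m * natToRing K n ≈⟨ distribʳ _ _ _ ⟨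
    (1# + natToRing K m) * natToRing K n          ∎

  natToRing-multiple : ∀ {p n} → CharacteristicDivides p → p ∣ n → natToRing K n ≈ 0#
  natToRing-multiple {p} char (divides q refl) = begin
    natToRing K (q ℕ.* p)           ≈⟨ natToRing-* q p ⟩
    natToRing K q * natToRing K p   ≈⟨ *-congˡ char ⟩
    natToRing K q * 0#              ≈⟨ zeroʳ _ ⟩
    0#                              ∎

module NatMultiples {K : CommutativeRing r ℓr} (L : Module K m ℓm) where
  open CommutativeRing K using (_*_; *-comm; 1#; +-identityʳ)
  open Module L
  open ModuleProperties L using (inverseʳ-uniqueᴹ)
  open SetoidReasoning ≈ᴹ-setoid

  infixr 8 _⊙_
  _⊙_ : ℕ → Carrierᴹ → Carrierᴹ
  n ⊙ v = natToRing K n *ₗ v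

  ⊙-+ : ∀ m n v → (m ℕ.+ n) ⊙ v ≈ᴹ m ⊙ v +ᴹ n ⊙ v
  ⊙-+ m n v = ≈ᴹ-trans (*ₗ-congʳ (natToRing-+ K m n)) (*ₗ-distribʳ v _ _)

  ⊙-* : ∀ m n v → (m ℕ.* n) ⊙ v ≈ᴹ m ⊙ (n ⊙ v)
  ⊙-* m n v = ≈ᴹ-trans (*ₗ-congʳ (natToRing-* K m n)) (*ₗ-assoc _ _ v)

  ⊙-*ₗ : ∀ n k v → n ⊙ (k *ₗ v) ≈ᴹ k *ₗ (n ⊙ v)
  ⊙-*ₗ n k v = begin
    natToRing K n *ₗ (k *ₗ v)   ≈⟨ *ₗ-assoc _ _ v ⟨
    (natToRing K n * k) *ₗ v    ≈⟨ *ₗ-congʳ (*-comm _ _) ⟩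
    (k * natToRing K n) *ₗ v    ≈⟨ *ₗ-assoc _ _ v ⟩
    k *ₗ (natToRing K n *ₗ v)   ∎

  1⊙ : ∀ v → 1 ⊙ v ≈ᴹ v
  1⊙ v = ≈ᴹ-trans (*ₗ-congʳ (+-identityʳ 1#)) (*ₗ-identityˡ v)

  module _ (p : ℕ) (char : CharacteristicDivides K p) where

    multiple⊙ : ∀ {n} → p ∣ n → ∀ v → n ⊙ v ≈ᴹ 0ᴹ
    multiple⊙ p∣n v = ≈ᴹ-trans (*ₗ-congʳ (natToRing-multiple K char p∣n)) (*ₗ-zeroˡ v)

    pred⊙ : .{{NonZero p}} → ∀ v → pred p ⊙ v ≈ᴹ -ᴹ v
    pred⊙ v = inverseʳ-uniqueᴹ v _ (begin
      v +ᴹ pred p ⊙ v          ≈⟨ +ᴹ-congʳ (1⊙ v) ⟨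
      1 ⊙ v +ᴹ pred p ⊙ v      ≈⟨ ⊙-+ 1 (pred p) v ⟨
      suc (pred p) ⊙ v         ≡⟨ cong (_⊙ v) (suc-pred p) ⟩
      p ⊙ v                    ≈⟨ multiple⊙ ∣-refl v ⟩
      0ᴹ                       ∎)

module NCPolynomials (p : ℕ) where

  -- Tries of noncommutative polynomials in X, Y, Z: node c P Q R is c + X P + Y Q + Z R.
  -- Words act on the right (X ⊗ Y sends v to [[v,x],y]); coefficients are read modulo p.
  data Poly : Set where
    0ₚ   : Poly
    node : ℕ → Poly → Poly → Poly → Poly

  infixl 6 _⊕_
  infixl 7 _⊗_
  infix  8 ⊖_

  _⊕_ : Poly → Poly → Poly
  0ₚ ⊕ Q = Q
  P@(node _ _ _ _) ⊕ 0ₚ = P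
  node c P₁ P₂ P₃ ⊕ node d Q₁ Q₂ Q₃ = node (c ℕ.+ d) (P₁ ⊕ Q₁) (P₂ ⊕ Q₂) (P₃ ⊕ Q₃)

  -- The first clause is semantically redundant, but without it every internal node of P
  -- leaves a zero copy of Q in P ⊗ Q, and the normal forms below blow up.
  scale : ℕ → Poly → Poly
  scale zero _ = 0ₚ
  scale (suc _) 0ₚ = 0ₚ
  scale k@(suc _) (node c P₁ P₂ P₃) = node (k ℕ.* c) (scale k P₁) (scale k P₂) (scale k P₃)

  ⊖_ : Poly → Poly
  ⊖_ = scale (pred p)

  _⊗_ : Poly → Poly → Poly
  0ₚ ⊗ Q = 0ₚ
  node c P₁ P₂ P₃ ⊗ Q = scale c Q ⊕ node 0 (P₁ ⊗ Q) (P₂ ⊗ Q) (P₃ ⊗ Q)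

  1ₚ X Y Z : Poly
  1ₚ = node 1 0ₚ 0ₚ 0ₚ
  X = node 0 1ₚ 0ₚ 0ₚ
  Y = node 0 0ₚ 1ₚ 0ₚ
  Z = node 0 0ₚ 0ₚ 1ₚ

  isZero : Poly → Bool
  isZero 0ₚ = true
  isZero (node c P₁ P₂ P₃) = isYes (p ∣? c) ∧ isZero P₁ ∧ isZero P₂ ∧ isZero P₃

  infix 4 _=ₚ_
  _=ₚ_ : Poly → Poly → Bool
  P =ₚ Q = isZero (P ⊕ ⊖ Q)

  infixl 6 _+ₜ_
  data Term : Set where
    𝐱 𝐲 𝐳  : Term
    ⁅_,_⁆ₜ : Term → Term → Term
    _+ₜ_   : Term → Term → Term

  ad : Term → Poly
  ad 𝐱 = X
  ad 𝐲 = Y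
  ad 𝐳 = Z
  ad ⁅ s , t ⁆ₜ = ad s ⊗ ad t ⊕ ⊖ (ad t ⊗ ad s)
  ad (s +ₜ t) = ad s ⊕ ad t

  square cube : Term → Poly
  square t = ad t ⊗ ad t
  cube t = ad t ⊗ ad t ⊗ ad t

  -- By inclusion–exclusion this is Σ_{σ ∈ S₃} ad b_σ1 ad b_σ2 ad b_σ3; no division is needed.
  linearisedCube : Term → Term → Term → Poly
  linearisedCube b₁ b₂ b₃ =
    cube (b₁ +ₜ b₂ +ₜ b₃) ⊕ ⊖ cube (b₁ +ₜ b₂) ⊕ ⊖ cube (b₁ +ₜ b₃) ⊕ ⊖ cube (b₂ +ₜ b₃)
      ⊕ cube b₁ ⊕ cube b₂ ⊕ cube b₃

  infix 6 _·_⊗⟨_,_,_⟩⊗_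
  data EngelInstance : Set where
    _·_⊗⟨_,_,_⟩⊗_ : ℕ → Poly → Term → Term → Term → Poly → EngelInstance

  instancePoly : EngelInstance → Poly
  instancePoly (k · P ⊗⟨ b₁ , b₂ , b₃ ⟩⊗ Q) = scale k (P ⊗ linearisedCube b₁ b₂ b₃ ⊗ Q)

  engelCombination : List EngelInstance → Poly
  engelCombination [] = 0ₚ
  engelCombination (e ∷ es) = instancePoly e ⊕ engelCombination es

module Evaluation {K : CommutativeRing r ℓr} (p : ℕ) (char : CharacteristicDivides K p)
  {L : Module K m ℓm} {⁅_,_⁆ : Op₂ (Module.Carrierᴹ L)} (lie : IsLieAlgebra L ⁅_,_⁆)
  (x y z : Module.Carrierᴹ L) where

  open CommutativeRing K using (0#)
  open Module L
  open IsLieAlgebra lie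
  open LieAlgebraProperties lie
  open NatMultiples L
  open NCPolynomials p
  open import Algebra.Properties.Group +ᴹ-group using (x∙y⁻¹≈ε⇒x≈y)
  open CommutativeSemigroupProperties (CommutativeMonoid.commutativeSemigroup +ᴹ-commutativeMonoid)
    using (interchange)
  open SetoidReasoning ≈ᴹ-setoid

  ⟦_⟧ : Poly → Carrierᴹ → Carrierᴹ
  ⟦ 0ₚ ⟧ v = 0ᴹ
  ⟦ node c P₁ P₂ P₃ ⟧ v = c ⊙ v +ᴹ (⟦ P₁ ⟧ ⁅ v , x ⁆ +ᴹ (⟦ P₂ ⟧ ⁅ v , y ⁆ +ᴹ ⟦ P₃ ⟧ ⁅ v , z ⁆))

  ⟦_⟧ₜ : Term → Carrierᴹ
  ⟦ 𝐱 ⟧ₜ = x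
  ⟦ 𝐲 ⟧ₜ = y
  ⟦ 𝐳 ⟧ₜ = z
  ⟦ ⁅ s , t ⁆ₜ ⟧ₜ = ⁅ ⟦ s ⟧ₜ , ⟦ t ⟧ₜ ⁆
  ⟦ s +ₜ t ⟧ₜ = ⟦ s ⟧ₜ +ᴹ ⟦ t ⟧ₜ

  private
    +ᴹ-cong₄ : ∀ {a b c d a′ b′ c′ d′} → a ≈ᴹ a′ → b ≈ᴹ b′ → c ≈ᴹ c′ → d ≈ᴹ d′ →
               a +ᴹ (b +ᴹ (c +ᴹ d)) ≈ᴹ a′ +ᴹ (b′ +ᴹ (c′ +ᴹ d′))
    +ᴹ-cong₄ a≈ b≈ c≈ d≈ = +ᴹ-cong a≈ (+ᴹ-cong b≈ (+ᴹ-cong c≈ d≈))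

    +ᴹ-interchange₄ : ∀ a b c d a′ b′ c′ d′ →
      (a +ᴹ a′) +ᴹ ((b +ᴹ b′) +ᴹ ((c +ᴹ c′) +ᴹ (d +ᴹ d′))) ≈ᴹ
      (a +ᴹ (b +ᴹ (c +ᴹ d))) +ᴹ (a′ +ᴹ (b′ +ᴹ (c′ +ᴹ d′)))
    +ᴹ-interchange₄ a b c d a′ b′ c′ d′ = begin
      (a +ᴹ a′) +ᴹ ((b +ᴹ b′) +ᴹ ((c +ᴹ c′) +ᴹ (d +ᴹ d′)))
        ≈⟨ +ᴹ-congˡ (+ᴹ-congˡ (interchange c c′ d d′)) ⟩
      (a +ᴹ a′) +ᴹ ((b +ᴹ b′) +ᴹ ((c +ᴹ d) +ᴹ (c′ +ᴹ d′)))
        ≈⟨ +ᴹ-congˡ (interchange b b′ _ _) ⟩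
      (a +ᴹ a′) +ᴹ ((b +ᴹ (c +ᴹ d)) +ᴹ (b′ +ᴹ (c′ +ᴹ d′)))
        ≈⟨ interchange a a′ _ _ ⟩
      (a +ᴹ (b +ᴹ (c +ᴹ d))) +ᴹ (a′ +ᴹ (b′ +ᴹ (c′ +ᴹ d′)))  ∎

    *ₗ-distrib₄ : ∀ k a b c d → k *ₗ (a +ᴹ (b +ᴹ (c +ᴹ d))) ≈ᴹ k *ₗ a +ᴹ (k *ₗ b +ᴹ (k *ₗ c +ᴹ k *ₗ d))
    *ₗ-distrib₄ k a b c d = ≈ᴹ-trans (*ₗ-distribˡ k _ _)
      (+ᴹ-congˡ (≈ᴹ-trans (*ₗ-distribˡ k _ _) (+ᴹ-congˡ (*ₗ-distribˡ k _ _))))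

    0ᴹ-sum₄ : 0ᴹ +ᴹ (0ᴹ +ᴹ (0ᴹ +ᴹ 0ᴹ)) ≈ᴹ 0ᴹ
    0ᴹ-sum₄ = ≈ᴹ-trans (+ᴹ-identityˡ _) (≈ᴹ-trans (+ᴹ-identityˡ _) (+ᴹ-identityˡ _))

  ⟦⟧-cong : ∀ P {u v} → u ≈ᴹ v → ⟦ P ⟧ u ≈ᴹ ⟦ P ⟧ v
  ⟦⟧-cong 0ₚ u≈v = ≈ᴹ-refl
  ⟦⟧-cong (node c P₁ P₂ P₃) u≈v = +ᴹ-cong₄ (*ₗ-congˡ u≈v)
    (⟦⟧-cong P₁ (⁅⁆-cong u≈v ≈ᴹ-refl)) (⟦⟧-cong P₂ (⁅⁆-cong u≈v ≈ᴹ-refl)) (⟦⟧-cong P₃ (⁅⁆-cong u≈v ≈ᴹ-refl))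

  ⟦⟧-+ᴹ : ∀ P u v → ⟦ P ⟧ (u +ᴹ v) ≈ᴹ ⟦ P ⟧ u +ᴹ ⟦ P ⟧ v
  ⟦⟧-+ᴹ 0ₚ u v = ≈ᴹ-sym (+ᴹ-identityˡ 0ᴹ)
  ⟦⟧-+ᴹ (node c P₁ P₂ P₃) u v = ≈ᴹ-trans
    (+ᴹ-cong₄ (*ₗ-distribˡ _ u v) (child P₁ x) (child P₂ y) (child P₃ z))
    (+ᴹ-interchange₄ _ _ _ _ _ _ _ _)
    where
    child : ∀ P w → ⟦ P ⟧ ⁅ u +ᴹ v , w ⁆ ≈ᴹ ⟦ P ⟧ ⁅ u , w ⁆ +ᴹ ⟦ P ⟧ ⁅ v , w ⁆
    child P w = ≈ᴹ-trans (⟦⟧-cong P (⁅⁆-+ˡ u v w)) (⟦⟧-+ᴹ P _ _)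

  ⟦⟧-*ₗ : ∀ P k v → ⟦ P ⟧ (k *ₗ v) ≈ᴹ k *ₗ ⟦ P ⟧ v
  ⟦⟧-*ₗ 0ₚ k v = ≈ᴹ-sym (*ₗ-zeroʳ k)
  ⟦⟧-*ₗ (node c P₁ P₂ P₃) k v = ≈ᴹ-trans
    (+ᴹ-cong₄ (⊙-*ₗ c k v) (child P₁ x) (child P₂ y) (child P₃ z))
    (≈ᴹ-sym (*ₗ-distrib₄ _ _ _ _ _))
    where
    child : ∀ P w → ⟦ P ⟧ ⁅ k *ₗ v , w ⁆ ≈ᴹ k *ₗ ⟦ P ⟧ ⁅ v , w ⁆
    child P w = ≈ᴹ-trans (⟦⟧-cong P (⁅⁆-*ˡ k v w)) (⟦⟧-*ₗ P k _)

  ⟦⟧-0ᴹ : ∀ P → ⟦ P ⟧ 0ᴹ ≈ᴹ 0ᴹ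
  ⟦⟧-0ᴹ P = begin
    ⟦ P ⟧ 0ᴹ            ≈⟨ ⟦⟧-cong P (*ₗ-zeroˡ 0ᴹ) ⟨
    ⟦ P ⟧ (0# *ₗ 0ᴹ)    ≈⟨ ⟦⟧-*ₗ P 0# 0ᴹ ⟩
    0# *ₗ ⟦ P ⟧ 0ᴹ      ≈⟨ *ₗ-zeroˡ _ ⟩
    0ᴹ                  ∎

  ⟦⊕⟧ : ∀ P Q v → ⟦ P ⊕ Q ⟧ v ≈ᴹ ⟦ P ⟧ v +ᴹ ⟦ Q ⟧ v
  ⟦⊕⟧ 0ₚ Q v = ≈ᴹ-sym (+ᴹ-identityˡ _)
  ⟦⊕⟧ (node _ _ _ _) 0ₚ v = ≈ᴹ-sym (+ᴹ-identityʳ _)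
  ⟦⊕⟧ (node c P₁ P₂ P₃) (node d Q₁ Q₂ Q₃) v = ≈ᴹ-trans
    (+ᴹ-cong₄ (⊙-+ c d v) (⟦⊕⟧ P₁ Q₁ _) (⟦⊕⟧ P₂ Q₂ _) (⟦⊕⟧ P₃ Q₃ _))
    (+ᴹ-interchange₄ _ _ _ _ _ _ _ _)

  ⟦scale⟧ : ∀ k P v → ⟦ scale k P ⟧ v ≈ᴹ k ⊙ ⟦ P ⟧ v
  ⟦scale⟧ zero P v = ≈ᴹ-sym (*ₗ-zeroˡ _)
  ⟦scale⟧ (suc _) 0ₚ v = ≈ᴹ-sym (*ₗ-zeroʳ _)
  ⟦scale⟧ k@(suc _) (node c P₁ P₂ P₃) v = ≈ᴹ-trans
    (+ᴹ-cong₄ (⊙-* k c v) (⟦scale⟧ k P₁ _) (⟦scale⟧ k P₂ _) (⟦scale⟧ k P₃ _))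
    (≈ᴹ-sym (*ₗ-distrib₄ _ _ _ _ _))

  ⟦⊖⟧ : .{{NonZero p}} → ∀ P v → ⟦ ⊖ P ⟧ v ≈ᴹ -ᴹ ⟦ P ⟧ v
  ⟦⊖⟧ P v = ≈ᴹ-trans (⟦scale⟧ (pred p) P v) (pred⊙ p char _)

  ⟦⊗⟧ : ∀ P Q v → ⟦ P ⊗ Q ⟧ v ≈ᴹ ⟦ Q ⟧ (⟦ P ⟧ v)
  ⟦⊗⟧ 0ₚ Q v = ≈ᴹ-sym (⟦⟧-0ᴹ Q)
  ⟦⊗⟧ (node c P₁ P₂ P₃) Q v = begin
    ⟦ scale c Q ⊕ node 0 (P₁ ⊗ Q) (P₂ ⊗ Q) (P₃ ⊗ Q) ⟧ v
      ≈⟨ ⟦⊕⟧ (scale c Q) _ v ⟩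
    ⟦ scale c Q ⟧ v +ᴹ (0 ⊙ v +ᴹ (⟦ P₁ ⊗ Q ⟧ ⁅ v , x ⁆ +ᴹ (⟦ P₂ ⊗ Q ⟧ ⁅ v , y ⁆ +ᴹ ⟦ P₃ ⊗ Q ⟧ ⁅ v , z ⁆)))
      ≈⟨ +ᴹ-cong (⟦scale⟧ c Q v) (≈ᴹ-trans (+ᴹ-congʳ (*ₗ-zeroˡ v)) (+ᴹ-identityˡ _)) ⟩
    c ⊙ ⟦ Q ⟧ v +ᴹ (⟦ P₁ ⊗ Q ⟧ ⁅ v , x ⁆ +ᴹ (⟦ P₂ ⊗ Q ⟧ ⁅ v , y ⁆ +ᴹ ⟦ P₃ ⊗ Q ⟧ ⁅ v , z ⁆))
      ≈⟨ +ᴹ-cong₄ (≈ᴹ-sym (⟦⟧-*ₗ Q _ v)) (⟦⊗⟧ P₁ Q _) (⟦⊗⟧ P₂ Q _) (⟦⊗⟧ P₃ Q _) ⟩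
    ⟦ Q ⟧ (c ⊙ v) +ᴹ (⟦ Q ⟧ (⟦ P₁ ⟧ ⁅ v , x ⁆) +ᴹ (⟦ Q ⟧ (⟦ P₂ ⟧ ⁅ v , y ⁆) +ᴹ ⟦ Q ⟧ (⟦ P₃ ⟧ ⁅ v , z ⁆)))
      ≈⟨ ⟦⟧-+ᴹ₄ ⟨
    ⟦ Q ⟧ (c ⊙ v +ᴹ (⟦ P₁ ⟧ ⁅ v , x ⁆ +ᴹ (⟦ P₂ ⟧ ⁅ v , y ⁆ +ᴹ ⟦ P₃ ⟧ ⁅ v , z ⁆)))  ∎
    where
    ⟦⟧-+ᴹ₄ : ∀ {a b c d} → ⟦ Q ⟧ (a +ᴹ (b +ᴹ (c +ᴹ d))) ≈ᴹ ⟦ Q ⟧ a +ᴹ (⟦ Q ⟧ b +ᴹ (⟦ Q ⟧ c +ᴹ ⟦ Q ⟧ d))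
    ⟦⟧-+ᴹ₄ = ≈ᴹ-trans (⟦⟧-+ᴹ Q _ _) (+ᴹ-congˡ (≈ᴹ-trans (⟦⟧-+ᴹ Q _ _) (+ᴹ-congˡ (⟦⟧-+ᴹ Q _ _))))

  ⟦1ₚ⟧ : ∀ v → ⟦ 1ₚ ⟧ v ≈ᴹ v
  ⟦1ₚ⟧ v = ≈ᴹ-trans (+ᴹ-congˡ (≈ᴹ-trans (+ᴹ-identityˡ _) (+ᴹ-identityˡ _)))
                    (≈ᴹ-trans (+ᴹ-identityʳ _) (1⊙ v))

  isZero-sound : ∀ P → T (isZero P) → ∀ v → ⟦ P ⟧ v ≈ᴹ 0ᴹ
  isZero-sound 0ₚ _ v = ≈ᴹ-refl
  isZero-sound (node c P₁ P₂ P₃) all v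
    with p∣c , all₁₂₃ ← Equivalence.to (T-∧ {isYes (p ∣? c)}) all
    with all₁ , all₂₃ ← Equivalence.to (T-∧ {isZero P₁}) all₁₂₃
    with all₂ , all₃ ← Equivalence.to (T-∧ {isZero P₂}) all₂₃
    = ≈ᴹ-trans (+ᴹ-cong₄ (multiple⊙ p char (toWitness p∣c) v)
        (isZero-sound P₁ all₁ _) (isZero-sound P₂ all₂ _) (isZero-sound P₃ all₃ _)) 0ᴹ-sum₄

  module _ .{{_ : NonZero p}} where

    =ₚ-sound : ∀ P Q → T (P =ₚ Q) → ∀ v → ⟦ P ⟧ v ≈ᴹ ⟦ Q ⟧ v
    =ₚ-sound P Q P=Q v = x∙y⁻¹≈ε⇒x≈y _ _ (begin
      ⟦ P ⟧ v +ᴹ -ᴹ ⟦ Q ⟧ v    ≈⟨ +ᴹ-congˡ (⟦⊖⟧ Q v) ⟨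
      ⟦ P ⟧ v +ᴹ ⟦ ⊖ Q ⟧ v     ≈⟨ ⟦⊕⟧ P (⊖ Q) v ⟨
      ⟦ P ⊕ ⊖ Q ⟧ v            ≈⟨ isZero-sound (P ⊕ ⊖ Q) P=Q v ⟩
      0ᴹ                       ∎)

    ⟦ad⟧ : ∀ t v → ⟦ ad t ⟧ v ≈ᴹ ⁅ v , ⟦ t ⟧ₜ ⁆
    ⟦ad⟧ 𝐱 v = begin
      0 ⊙ v +ᴹ (⟦ 1ₚ ⟧ ⁅ v , x ⁆ +ᴹ (0ᴹ +ᴹ 0ᴹ))  ≈⟨ +ᴹ-cong₄ (*ₗ-zeroˡ v) (⟦1ₚ⟧ _) ≈ᴹ-refl ≈ᴹ-refl ⟩
      0ᴹ +ᴹ (⁅ v , x ⁆ +ᴹ (0ᴹ +ᴹ 0ᴹ))             ≈⟨ +ᴹ-identityˡ _ ⟩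
      ⁅ v , x ⁆ +ᴹ (0ᴹ +ᴹ 0ᴹ)                    ≈⟨ +ᴹ-congˡ (+ᴹ-identityˡ 0ᴹ) ⟩
      ⁅ v , x ⁆ +ᴹ 0ᴹ                            ≈⟨ +ᴹ-identityʳ _ ⟩
      ⁅ v , x ⁆                                  ∎
    ⟦ad⟧ 𝐲 v = begin
      0 ⊙ v +ᴹ (0ᴹ +ᴹ (⟦ 1ₚ ⟧ ⁅ v , y ⁆ +ᴹ 0ᴹ))  ≈⟨ +ᴹ-cong₄ (*ₗ-zeroˡ v) ≈ᴹ-refl (⟦1ₚ⟧ _) ≈ᴹ-refl ⟩
      0ᴹ +ᴹ (0ᴹ +ᴹ (⁅ v , y ⁆ +ᴹ 0ᴹ))             ≈⟨ ≈ᴹ-trans (+ᴹ-identityˡ _) (+ᴹ-identityˡ _) ⟩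
      ⁅ v , y ⁆ +ᴹ 0ᴹ                            ≈⟨ +ᴹ-identityʳ _ ⟩
      ⁅ v , y ⁆                                  ∎
    ⟦ad⟧ 𝐳 v = begin
      0 ⊙ v +ᴹ (0ᴹ +ᴹ (0ᴹ +ᴹ ⟦ 1ₚ ⟧ ⁅ v , z ⁆))  ≈⟨ +ᴹ-cong₄ (*ₗ-zeroˡ v) ≈ᴹ-refl ≈ᴹ-refl (⟦1ₚ⟧ _) ⟩
      0ᴹ +ᴹ (0ᴹ +ᴹ (0ᴹ +ᴹ ⁅ v , z ⁆))             ≈⟨ ≈ᴹ-trans (+ᴹ-identityˡ _) (+ᴹ-identityˡ _) ⟩
      0ᴹ +ᴹ ⁅ v , z ⁆                            ≈⟨ +ᴹ-identityˡ _ ⟩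
      ⁅ v , z ⁆                                  ∎
    ⟦ad⟧ ⁅ s , t ⁆ₜ v = begin
      ⟦ ad s ⊗ ad t ⊕ ⊖ (ad t ⊗ ad s) ⟧ v
        ≈⟨ ⟦⊕⟧ (ad s ⊗ ad t) _ v ⟩
      ⟦ ad s ⊗ ad t ⟧ v +ᴹ ⟦ ⊖ (ad t ⊗ ad s) ⟧ v
        ≈⟨ +ᴹ-cong (⟦⊗⟧ (ad s) (ad t) v) (≈ᴹ-trans (⟦⊖⟧ (ad t ⊗ ad s) v) (-ᴹ‿cong (⟦⊗⟧ (ad t) (ad s) v))) ⟩
      ⟦ ad t ⟧ (⟦ ad s ⟧ v) +ᴹ -ᴹ ⟦ ad s ⟧ (⟦ ad t ⟧ v)
        ≈⟨ +ᴹ-cong (nested s t) (-ᴹ‿cong (nested t s)) ⟩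
      ⁅ ⁅ v , ⟦ s ⟧ₜ ⁆ , ⟦ t ⟧ₜ ⁆ +ᴹ -ᴹ ⁅ ⁅ v , ⟦ t ⟧ₜ ⁆ , ⟦ s ⟧ₜ ⁆
        ≈⟨ ⁅⁆-leibniz v _ _ ⟨
      ⁅ v , ⁅ ⟦ s ⟧ₜ , ⟦ t ⟧ₜ ⁆ ⁆  ∎
      where
      nested : ∀ s t → ⟦ ad t ⟧ (⟦ ad s ⟧ v) ≈ᴹ ⁅ ⁅ v , ⟦ s ⟧ₜ ⁆ , ⟦ t ⟧ₜ ⁆
      nested s t = ≈ᴹ-trans (⟦ad⟧ t _) (⁅⁆-cong (⟦ad⟧ s v) ≈ᴹ-refl)
    ⟦ad⟧ (s +ₜ t) v = ≈ᴹ-trans (⟦⊕⟧ (ad s) (ad t) v)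
      (≈ᴹ-trans (+ᴹ-cong (⟦ad⟧ s v) (⟦ad⟧ t v)) (≈ᴹ-sym (⁅⁆-+ʳ v _ _)))

    ⟦square⟧ : ∀ t v → ⟦ square t ⟧ v ≈ᴹ ⁅ ⁅ v , ⟦ t ⟧ₜ ⁆ , ⟦ t ⟧ₜ ⁆
    ⟦square⟧ t v = ≈ᴹ-trans (⟦⊗⟧ (ad t) (ad t) v) (≈ᴹ-trans (⟦ad⟧ t _) (⁅⁆-cong (⟦ad⟧ t v) ≈ᴹ-refl))

  record Annihilating (C : Poly) : Set (m ⊔ ℓm) where
    constructor mkAnnihilating
    field annihilates : ∀ v → ⟦ C ⟧ v ≈ᴹ 0ᴹ
  open Annihilating public

  annihilating-⊕ : ∀ {C D} → Annihilating C → Annihilating D → Annihilating (C ⊕ D)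
  annihilating-⊕ {C} {D} C≈0 D≈0 = mkAnnihilating λ v →
    ≈ᴹ-trans (⟦⊕⟧ C D v) (≈ᴹ-trans (+ᴹ-cong (annihilates C≈0 v) (annihilates D≈0 v)) (+ᴹ-identityˡ 0ᴹ))

  annihilating-scale : ∀ k {C} → Annihilating C → Annihilating (scale k C)
  annihilating-scale k {C} C≈0 = mkAnnihilating λ v →
    ≈ᴹ-trans (⟦scale⟧ k C v) (≈ᴹ-trans (*ₗ-congˡ (annihilates C≈0 v)) (*ₗ-zeroʳ _))

  annihilating-⊗ : ∀ P {C} Q → Annihilating C → Annihilating (P ⊗ C ⊗ Q)
  annihilating-⊗ P {C} Q C≈0 = mkAnnihilating λ v → begin
    ⟦ P ⊗ C ⊗ Q ⟧ v         ≈⟨ ⟦⊗⟧ (P ⊗ C) Q v ⟩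
    ⟦ Q ⟧ (⟦ P ⊗ C ⟧ v)     ≈⟨ ⟦⟧-cong Q (≈ᴹ-trans (⟦⊗⟧ P C v) (annihilates C≈0 _)) ⟩
    ⟦ Q ⟧ 0ᴹ                ≈⟨ ⟦⟧-0ᴹ Q ⟩
    0ᴹ                      ∎

  module _ .{{_ : NonZero p}} (engel : Is3Engel L ⁅_,_⁆) where

    annihilating-cube : ∀ t → Annihilating (cube t)
    annihilating-cube t = mkAnnihilating λ v → begin
      ⟦ ad t ⊗ ad t ⊗ ad t ⟧ v                  ≈⟨ ⟦⊗⟧ (ad t ⊗ ad t) (ad t) v ⟩
      ⟦ ad t ⟧ (⟦ ad t ⊗ ad t ⟧ v)              ≈⟨ ⟦ad⟧ t _ ⟩
      ⁅ ⟦ ad t ⊗ ad t ⟧ v , ⟦ t ⟧ₜ ⁆            ≈⟨ ⁅⁆-cong (⟦square⟧ t v) ≈ᴹ-refl ⟩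
      ⁅ ⁅ ⁅ v , ⟦ t ⟧ₜ ⁆ , ⟦ t ⟧ₜ ⁆ , ⟦ t ⟧ₜ ⁆  ≈⟨ engel v _ ⟩
      0ᴹ                                        ∎

    annihilating-linearisedCube : ∀ b₁ b₂ b₃ → Annihilating (linearisedCube b₁ b₂ b₃)
    annihilating-linearisedCube b₁ b₂ b₃ =
      annihilating-cube (b₁ +ₜ b₂ +ₜ b₃) ⊕ᴬ ⊖cube (b₁ +ₜ b₂) ⊕ᴬ ⊖cube (b₁ +ₜ b₃) ⊕ᴬ ⊖cube (b₂ +ₜ b₃)
        ⊕ᴬ annihilating-cube b₁ ⊕ᴬ annihilating-cube b₂ ⊕ᴬ annihilating-cube b₃
      where
      infixl 6 _⊕ᴬ_
      _⊕ᴬ_ : ∀ {C D} → Annihilating C → Annihilating D → Annihilating (C ⊕ D)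
      _⊕ᴬ_ = annihilating-⊕

      ⊖cube : ∀ t → Annihilating (⊖ cube t)
      ⊖cube t = annihilating-scale (pred p) (annihilating-cube t)

    annihilating-engelCombination : ∀ es → Annihilating (engelCombination es)
    annihilating-engelCombination [] = mkAnnihilating λ _ → ≈ᴹ-refl
    annihilating-engelCombination ((k · P ⊗⟨ b₁ , b₂ , b₃ ⟩⊗ Q) ∷ es) = annihilating-⊕
      (annihilating-scale k (annihilating-⊗ P Q (annihilating-linearisedCube b₁ b₂ b₃)))
      (annihilating-engelCombination es)

open NCPolynomials 5

certificate : List EngelInstance
certificate =
    2 · 1ₚ ⊗⟨ 𝐱 , 𝐱 , 𝐲 ⟩⊗ Z ⊗ Z ⊗ Y
  ∷ 2 · 1ₚ ⊗⟨ 𝐱 , 𝐱 , 𝐳 ⟩⊗ Y ⊗ Z ⊗ Y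
  ∷ 4 · 1ₚ ⊗⟨ 𝐱 , 𝐱 , 𝐳 ⟩⊗ Z ⊗ Y ⊗ Y
  ∷ 1 · 1ₚ ⊗⟨ 𝐱 , 𝐱 , ⁅ 𝐲 , 𝐳 ⁆ₜ ⟩⊗ Z ⊗ Y
  ∷ 3 · 1ₚ ⊗⟨ 𝐱 , 𝐲 , 𝐲 ⟩⊗ Z ⊗ Z ⊗ X
  ∷ 1 · 1ₚ ⊗⟨ 𝐱 , 𝐱 , ⁅ ⁅ ⁅ 𝐲 , 𝐳 ⁆ₜ , 𝐲 ⁆ₜ , 𝐳 ⁆ₜ ⟩⊗ 1ₚ
  ∷ 3 · 1ₚ ⊗⟨ 𝐱 , 𝐱 , 𝐲 ⟩⊗ Y ⊗ Z ⊗ Z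
  ∷ 1 · 1ₚ ⊗⟨ 𝐱 , 𝐱 , 𝐲 ⟩⊗ Z ⊗ Y ⊗ Z
  ∷ 2 · 1ₚ ⊗⟨ 𝐱 , 𝐱 , ⁅ ⁅ 𝐲 , 𝐳 ⁆ₜ , 𝐲 ⁆ₜ ⟩⊗ Z
  ∷ 3 · 1ₚ ⊗⟨ 𝐱 , 𝐲 , 𝐳 ⟩⊗ X ⊗ Z ⊗ Y
  ∷ 4 · 1ₚ ⊗⟨ 𝐱 , 𝐲 , 𝐳 ⟩⊗ Z ⊗ X ⊗ Y
  ∷ 2 · 1ₚ ⊗⟨ 𝐱 , 𝐲 , 𝐳 ⟩⊗ Y ⊗ X ⊗ Z
  ∷ 1 · X ⊗ Y ⊗⟨ 𝐱 , 𝐲 , 𝐳 ⟩⊗ Z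
  ∷ 3 · 1ₚ ⊗⟨ 𝐱 , 𝐱 , ⁅ 𝐲 , 𝐳 ⁆ₜ ⟩⊗ Y ⊗ Z
  ∷ 3 · 1ₚ ⊗⟨ 𝐱 , 𝐲 , 𝐲 ⟩⊗ X ⊗ Z ⊗ Z
  ∷ 4 · 1ₚ ⊗⟨ 𝐱 , 𝐲 , 𝐳 ⟩⊗ X ⊗ Y ⊗ Z
  ∷ 2 · 1ₚ ⊗⟨ 𝐱 , 𝐲 , ⁅ 𝐲 , 𝐳 ⁆ₜ ⟩⊗ X ⊗ Z
  ∷ 1 · X ⊗ Z ⊗⟨ 𝐱 , 𝐲 , ⁅ 𝐲 , 𝐳 ⁆ₜ ⟩⊗ 1ₚ
  ∷ 3 · 1ₚ ⊗⟨ 𝐱 , 𝐲 , ⁅ 𝐲 , 𝐳 ⁆ₜ ⟩⊗ Z ⊗ X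
  ∷ 3 · 1ₚ ⊗⟨ 𝐱 , 𝐲 , ⁅ ⁅ 𝐲 , 𝐳 ⁆ₜ , 𝐳 ⁆ₜ ⟩⊗ X
  ∷ 1 · X ⊗ Y ⊗ Z ⊗⟨ 𝐱 , 𝐲 , 𝐳 ⟩⊗ 1ₚ
  ∷ 1 · 1ₚ ⊗⟨ 𝐱 , 𝐲 , ⁅ ⁅ ⁅ 𝐱 , 𝐲 ⁆ₜ , 𝐳 ⁆ₜ , 𝐳 ⁆ₜ ⟩⊗ 1ₚ
  ∷ 3 · Y ⊗⟨ 𝐱 , 𝐱 , 𝐳 ⟩⊗ Y ⊗ Z
  ∷ 2 · Y ⊗⟨ 𝐱 , 𝐱 , 𝐳 ⟩⊗ Z ⊗ Y
  ∷ 1 · Y ⊗⟨ 𝐱 , 𝐱 , ⁅ ⁅ 𝐲 , 𝐳 ⁆ₜ , 𝐳 ⁆ₜ ⟩⊗ 1ₚ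
  ∷ 3 · Y ⊗⟨ 𝐱 , 𝐱 , ⁅ 𝐲 , 𝐳 ⁆ₜ ⟩⊗ Z
  ∷ 3 · Y ⊗ X ⊗ Z ⊗⟨ 𝐱 , 𝐲 , 𝐳 ⟩⊗ 1ₚ
  ∷ 1 · Y ⊗⟨ 𝐱 , 𝐳 , 𝐳 ⟩⊗ Y ⊗ X
  ∷ 1 · Y ⊗ Y ⊗ Z ⊗⟨ 𝐱 , 𝐱 , 𝐳 ⟩⊗ 1ₚ
  ∷ 3 · 1ₚ ⊗⟨ 𝐱 , 𝐳 , 𝐳 ⟩⊗ X ⊗ Y ⊗ Y
  ∷ 2 · 1ₚ ⊗⟨ 𝐱 , 𝐲 , ⁅ ⁅ ⁅ 𝐱 , 𝐳 ⁆ₜ , 𝐲 ⁆ₜ , 𝐳 ⁆ₜ ⟩⊗ 1ₚ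
  ∷ 1 · X ⊗ Y ⊗ Y ⊗⟨ 𝐱 , 𝐳 , 𝐳 ⟩⊗ 1ₚ
  ∷ 3 · 1ₚ ⊗⟨ 𝐱 , 𝐳 , 𝐳 ⟩⊗ Y ⊗ Y ⊗ X
  ∷ 3 · Y ⊗ Y ⊗⟨ 𝐱 , 𝐳 , 𝐳 ⟩⊗ X
  ∷ 2 · Y ⊗ Z ⊗⟨ 𝐱 , 𝐱 , 𝐳 ⟩⊗ Y
  ∷ 2 · X ⊗ Y ⊗⟨ 𝐱 , 𝐳 , 𝐳 ⟩⊗ Y
  ∷ 3 · Y ⊗ Z ⊗⟨ 𝐱 , 𝐱 , 𝐲 ⟩⊗ Z
  ∷ 2 · Y ⊗ Z ⊗⟨ 𝐱 , 𝐱 , ⁅ 𝐲 , 𝐳 ⁆ₜ ⟩⊗ 1ₚ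
  ∷ 2 · Y ⊗⟨ 𝐱 , 𝐳 , ⁅ 𝐲 , 𝐳 ⁆ₜ ⟩⊗ X
  ∷ 1 · Y ⊗⟨ 𝐱 , 𝐳 , 𝐳 ⟩⊗ X ⊗ Y
  ∷ 4 · Y ⊗ Z ⊗ Y ⊗⟨ 𝐱 , 𝐱 , 𝐳 ⟩⊗ 1ₚ
  ∷ 4 · 1ₚ ⊗⟨ 𝐱 , 𝐳 , ⁅ 𝐲 , 𝐳 ⁆ₜ ⟩⊗ Y ⊗ X
  ∷ 4 · Y ⊗ Z ⊗ Z ⊗⟨ 𝐱 , 𝐱 , 𝐲 ⟩⊗ 1ₚ
  ∷ 2 · X ⊗ Y ⊗⟨ 𝐱 , 𝐳 , ⁅ 𝐲 , 𝐳 ⁆ₜ ⟩⊗ 1ₚ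
  ∷ 3 · 1ₚ ⊗⟨ 𝐱 , 𝐳 , ⁅ 𝐲 , 𝐳 ⁆ₜ ⟩⊗ X ⊗ Y
  ∷ 4 · Z ⊗⟨ 𝐱 , 𝐱 , 𝐲 ⟩⊗ Y ⊗ Z
  ∷ 4 · Z ⊗⟨ 𝐱 , 𝐱 , ⁅ ⁅ 𝐲 , 𝐳 ⁆ₜ , 𝐲 ⁆ₜ ⟩⊗ 1ₚ
  ∷ 4 · Z ⊗⟨ 𝐱 , 𝐲 , 𝐲 ⟩⊗ X ⊗ Z
  ∷ 4 · Z ⊗⟨ 𝐱 , 𝐲 , 𝐲 ⟩⊗ Z ⊗ X
  ∷ 3 · Z ⊗⟨ 𝐱 , 𝐲 , 𝐳 ⟩⊗ X ⊗ Y
  ∷ 4 · Z ⊗ Y ⊗⟨ 𝐱 , 𝐱 , ⁅ 𝐲 , 𝐳 ⁆ₜ ⟩⊗ 1ₚ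
  ∷ 2 · Z ⊗ Y ⊗⟨ 𝐱 , 𝐱 , 𝐲 ⟩⊗ Z
  ∷ 4 · 1ₚ ⊗⟨ 𝐱 , 𝐳 , ⁅ ⁅ 𝐱 , 𝐲 ⁆ₜ , 𝐲 ⁆ₜ ⟩⊗ Z
  ∷ 4 · Z ⊗⟨ 𝐱 , 𝐲 , 𝐳 ⟩⊗ Y ⊗ X
  ∷ 2 · Z ⊗⟨ 𝐱 , 𝐲 , ⁅ ⁅ 𝐱 , 𝐲 ⁆ₜ , 𝐳 ⁆ₜ ⟩⊗ 1ₚ
  ∷ 1 · Z ⊗ Y ⊗ Y ⊗⟨ 𝐱 , 𝐱 , 𝐳 ⟩⊗ 1ₚ
  ∷ 1 · 1ₚ ⊗⟨ 𝐱 , 𝐳 , ⁅ ⁅ ⁅ 𝐱 , 𝐲 ⁆ₜ , 𝐲 ⁆ₜ , 𝐳 ⁆ₜ ⟩⊗ 1ₚ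
  ∷ 3 · 1ₚ ⊗⟨ 𝐱 , 𝐳 , ⁅ ⁅ 𝐱 , 𝐲 ⁆ₜ , 𝐳 ⁆ₜ ⟩⊗ Y
  ∷ 3 · Z ⊗ Y ⊗ Z ⊗⟨ 𝐱 , 𝐱 , 𝐲 ⟩⊗ 1ₚ
  ∷ 2 · 1ₚ ⊗⟨ 𝐱 , ⁅ 𝐲 , 𝐳 ⁆ₜ , ⁅ 𝐲 , 𝐳 ⁆ₜ ⟩⊗ X
  ∷ 2 · 1ₚ ⊗⟨ 𝐲 , 𝐲 , 𝐳 ⟩⊗ X ⊗ X ⊗ Z
  ∷ 2 · Z ⊗ Z ⊗⟨ 𝐱 , 𝐱 , 𝐲 ⟩⊗ Y
  ∷ 1 · 1ₚ ⊗⟨ 𝐲 , 𝐲 , 𝐳 ⟩⊗ Z ⊗ X ⊗ X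
  ∷ 2 · Z ⊗ Z ⊗ Y ⊗⟨ 𝐱 , 𝐱 , 𝐲 ⟩⊗ 1ₚ
  ∷ 4 · 1ₚ ⊗⟨ 𝐲 , 𝐳 , 𝐳 ⟩⊗ X ⊗ X ⊗ Y
  ∷ []

fₐ-invariant : ∀ {K : CommutativeRing r ℓr} → CharacteristicDivides K 5 →
  {L : Module K m ℓm} {⁅_,_⁆ : Op₂ (Module.Carrierᴹ L)} → IsLieAlgebra L ⁅_,_⁆ → Is3Engel L ⁅_,_⁆ →
  let open Module L in
  ∀ a x y z → fₐ L ⁅_,_⁆ a ⁅ x , y ⁆ z ≈ᴹ fₐ L ⁅_,_⁆ a x ⁅ y , z ⁆
fₐ-invariant char {L} {⁅_,_⁆} lie engel a x y z = begin
  fₐ L ⁅_,_⁆ a ⁅ x , y ⁆ z              ≈⟨ ⟦square⟧ t₁ a ⟨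
  ⟦ square t₁ ⟧ a                       ≈⟨ =ₚ-sound (square t₁) (square t₂ ⊕ C) tt a ⟩
  ⟦ square t₂ ⊕ C ⟧ a                   ≈⟨ ⟦⊕⟧ (square t₂) C a ⟩
  ⟦ square t₂ ⟧ a +ᴹ ⟦ C ⟧ a            ≈⟨ +ᴹ-cong (⟦square⟧ t₂ a) (annihilates C≈0 a) ⟩
  fₐ L ⁅_,_⁆ a x ⁅ y , z ⁆ +ᴹ 0ᴹ        ≈⟨ +ᴹ-identityʳ _ ⟩
  fₐ L ⁅_,_⁆ a x ⁅ y , z ⁆              ∎
  where
  open Module L
  open Evaluation 5 char lie x y z
  open SetoidReasoning ≈ᴹ-setoid

  t₁ t₂ : Term
  t₁ = ⁅ ⁅ 𝐱 , 𝐲 ⁆ₜ , 𝐳 ⁆ₜ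
  t₂ = ⁅ 𝐱 , ⁅ 𝐲 , 𝐳 ⁆ₜ ⁆ₜ

  C : Poly
  C = engelCombination certificate

  C≈0 : Annihilating C
  C≈0 = annihilating-engelCombination engel certificate

mainTheorem4 : ∀ {r ℓr m ℓm : Level} (K : CommutativeRing r ℓr) → IsField K → HasCharacteristic K 5 →
    (L : Module K m ℓm) (⁅_,_⁆ : Op₂ (Module.Carrierᴹ L)) →
    IsLieAlgebra L ⁅_,_⁆ → Is3Engel L ⁅_,_⁆ →
    (a : Module.Carrierᴹ L) →
    let open Module L in
    ∀ x y z →
      (fₐ L ⁅_,_⁆ a x x ≈ᴹ 0ᴹ)
      × (fₐ L ⁅_,_⁆ a x y ≈ᴹ fₐ L ⁅_,_⁆ a y x)
      × (fₐ L ⁅_,_⁆ a ⁅ x , y ⁆ z ≈ᴹ fₐ L ⁅_,_⁆ a x ⁅ y , z ⁆)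
mainTheorem4 K _ char5 L ⁅_,_⁆ lie engel a x y z =
  fₐ-diagonal a x , fₐ-comm a x y , fₐ-invariant (HasCharacteristic.annihil char5) lie engel a x y z
  where open LieAlgebraProperties lie
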